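{- For every odd $k \ge 5$, the graph $F_2(k)$ is word-representable.
   Context: A graph $G=(V,E)$ is word-representable if there is a word $w$ over $V$ such that for all distinct $a,b\in V$, $ab\in E$ iff $a$ and $b$ alternate in $w$ (the subsequence of $w$ formed by the occurrences of $a$ and $b$ is $abab\cdots$ or $baba\cdots$). For odd $k\ge5$, $F_2(k)$ is the split graph with clique $C=\{c_1,\dots,c_k\}$, independent set $I=\{b,a_1,\dots,a_{k-1}\}$, and $N(b)=\{c_2,\dots,c_{k-1}\}$, $N(a_i)=\{c_i,c_{i+1}\}$ for $1\le i\le k-1$. -}

module Defs where

open import Data.Nat using (ℕ; zero; suc; _≤_; _∸_)
open import Data.Fin using (Fin; toℕ)
import Data.Fin.Properties as FinP
open import Data.List using (List; []; _∷_)
open import Data.List.Membership.Propositional using (_∈_)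
open import Data.Product using (_×_; ∃; _,_)
open import Data.Sum using (_⊎_)
open import Data.Unit using (⊤)
open import Data.Empty using (⊥)
open import Relation.Nullary using (¬_; yes; no)
open import Relation.Binary.Definitions using (DecidableEquality)
open import Relation.Binary.PropositionalEquality using (_≡_; refl; _≢_; cong)
open import Function.Bundles using (_⇔_)

-- A (simple, undirected) graph: vertex type with decidable equality
-- and an adjacency relation (only consulted on distinct vertices).
record Graph : Set₁ where
  field
    V    : Set
    _≟V_ : DecidableEquality V
    Adj  : V → V → Set

restrict : {V : Set} → DecidableEquality V → V → V → List V → List V
restrict _≟_ x y [] = []
restrict _≟_ x y (z ∷ w) with z ≟ x | z ≟ y
... | yes _ | _     = z ∷ restrict _≟_ x y w
... | no _  | yes _ = z ∷ restrict _≟_ x y w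
... | no _  | no _  = restrict _≟_ x y w

NoAdjRepeat : {V : Set} → List V → Set
NoAdjRepeat [] = ⊤
NoAdjRepeat (x ∷ []) = ⊤
NoAdjRepeat (x ∷ y ∷ r) = x ≢ y × NoAdjRepeat (y ∷ r)

-- x and y alternate in w: the subsequence formed by the occurrences of x
-- and y is xyxy... or yxyx... (for distinct x y this is exactly the
-- absence of two consecutive equal letters in that subsequence).
Alternate : {V : Set} → DecidableEquality V → V → V → List V → Set
Alternate eq x y w = NoAdjRepeat (restrict eq x y w)

WordRepresentable : Graph → Set
WordRepresentable G =
  ∃ λ (w : List V) →
    (∀ v → v ∈ w) ×
    (∀ x y → x ≢ y → (Adj x y ⇔ Alternate _≟V_ x y w))
  where open Graph G

-- Vertices of F₂(k), 0-indexed: c i  is c_{i+1} (i < k),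
-- bv is b, a j is a_{j+1} (j < k-1).
data F2V (k : ℕ) : Set where
  c  : Fin k → F2V k
  bv : F2V k
  a  : Fin (k ∸ 1) → F2V k

c-inj : ∀ {k} {i j : Fin k} → c {k} i ≡ c j → i ≡ j
c-inj refl = refl

a-inj : ∀ {k} {i j : Fin (k ∸ 1)} → a {k} i ≡ a j → i ≡ j
a-inj refl = refl

F2V-≟ : ∀ k → DecidableEquality (F2V k)
F2V-≟ k (c i) (c j) with i FinP.≟ j
... | yes p = yes (cong c p)
... | no ¬p = no (λ e → ¬p (c-inj e))
F2V-≟ k (c i) bv = no (λ ())
F2V-≟ k (c i) (a j) = no (λ ())
F2V-≟ k bv (c j) = no (λ ())
F2V-≟ k bv bv = yes refl
F2V-≟ k bv (a j) = no (λ ())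
F2V-≟ k (a i) (c j) = no (λ ())
F2V-≟ k (a i) bv = no (λ ())
F2V-≟ k (a i) (a j) with i FinP.≟ j
... | yes p = yes (cong a p)
... | no ¬p = no (λ e → ¬p (a-inj e))

-- N(b) = {c_2, …, c_{k-1}}: 0-based indices 1 … k-2.
InNb : ∀ {k} → Fin k → Set
InNb {k} i = 1 ≤ toℕ i × toℕ i ≤ k ∸ 2

-- N(a_j) = {c_j, c_{j+1}}: 0-based a j adjacent to c j and c (j+1).
InNa : ∀ {k} → Fin (k ∸ 1) → Fin k → Set
InNa j i = toℕ i ≡ toℕ j ⊎ toℕ i ≡ suc (toℕ j)

F2Adj : ∀ k → F2V k → F2V k → Set
F2Adj k (c i) (c j) = i ≢ j
F2Adj k (c i) bv    = InNb i
F2Adj k bv (c i)    = InNb i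
F2Adj k (c i) (a j) = InNa j i
F2Adj k (a j) (c i) = InNa j i
F2Adj k _ _         = ⊥              -- I is independent

F₂ : ℕ → Graph
F₂ k = record { V = F2V k ; _≟V_ = F2V-≟ k ; Adj = F2Adj k }

-- With k = 2p + 3 and 0-based indices, F₂(k) is represented by the word
--
--   b [a₀ c₀ c₁ a₀] [a₂ c₂ c₃ a₂] ⋯ [a₂ₚ c₂ₚ c₂ₚ₊₁ a₂ₚ] c₂ₚ₊₂ c₀
--   b [a₁ c₁ c₂ a₁] ⋯ [a₂ₚ₋₁ c₂ₚ₋₁ c₂ₚ a₂ₚ₋₁] a₂ₚ₊₁ c₂ₚ₊₁
--   b c₂ₚ₊₂ a₂ₚ₊₁ .
--
-- Its clique letters read c₀ ⋯ c₂ₚ₊₂ c₀ ⋯ c₂ₚ₊₂, so any two of them alternate.  Each aⱼ occurs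
-- twice, enclosing exactly cⱼ cⱼ₊₁ and, for j = 2p + 1 only, the third b; since every cᵢ occurs
-- twice, aⱼ alternates with cᵢ iff i ∈ {j, j + 1}, and with no other aᵢ.  Nor does a₂ₚ₊₁
-- alternate with b, as the first two b's enclose no a₂ₚ₊₁.  Between consecutive b's lie
-- c₀ ⋯ c₂ₚ₊₂ c₀ and c₁ ⋯ c₂ₚ₊₁, so b alternates with cᵢ exactly when 1 ≤ i ≤ 2p + 1.

module Submission where

open import Data.Bool using (Bool; true; false)
open import Data.Empty using (⊥-elim)
open import Data.List using (List; []; _∷_; _++_; map; filterᵇ)
open import Data.List.Properties using (++-assoc; ++-identityʳ; filter-++)
open import Data.List.Membership.Propositional using (_∈_)
open import Data.List.Membership.Propositional.Properties using (∈-map⁺; ∈-++⁺ʳ)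
open import Data.List.Relation.Unary.All using (All; []; _∷_)
open import Data.List.Relation.Unary.All.Properties using (++⁺)
open import Data.List.Relation.Unary.Any using (here; there)
open import Data.Nat
  using (ℕ; zero; suc; _+_; _*_; _≤_; _<_; _%_; _/_; _≤?_; z≤n; s≤s; NonZero) renaming (_≟_ to _≟ℕ_)
open import Data.Nat.Properties
  using ( suc-injective; m+1+n≢0; +-suc; +-identityʳ; ≤-refl; ≤-trans; n≤1+n; n<1+n; m≤m+n
        ; <⇒≱; <⇒≢; >⇒≢; ≤∧≢⇒<; ≰⇒>; m<n⇒m<1+n; m≤n⇒m<n∨m≡n; m<1+n⇒m<n∨m≡n)
open import Data.Product using (_×_; _,_; proj₁; ∃)
open import Data.Sum using (_⊎_; inj₁; inj₂)
open import Data.Unit using (⊤; tt)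
open import Data.Fin using (Fin; toℕ)
open import Data.Fin.Properties using (toℕ-injective; toℕ<n; toℕ-fromℕ<)
open import Data.Nat.DivMod using (_mod_; m%n<n; m<n⇒m%n≡m; m≡m%n+[m/n]*n)
open import Function.Base using (_∘_)
open import Function.Bundles using (_⇔_; mk⇔; Equivalence)
open import Function.Construct.Composition using (_⇔-∘_)
open import Function.Construct.Symmetry using (⇔-sym)
open import Function.Definitions using (Injective)
open import Relation.Nullary using (¬_; yes; no)
open import Relation.Nullary.Decidable using (map′; T?)
open import Relation.Binary.Definitions using (DecidableEquality)
open import Relation.Binary.PropositionalEquality
  using (_≡_; _≢_; refl; sym; trans; cong; cong₂; subst; module ≡-Reasoning)

open import Defs

true≢false : true ≢ false
true≢false ()

m+1+n≡2 : ∀ m n → m + suc n ≡ 2 → (m ≡ 0 × n ≡ 1) ⊎ (m ≡ 1 × n ≡ 0)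
m+1+n≡2 0 n eq = inj₁ (refl , suc-injective eq)
m+1+n≡2 1 0 eq = inj₂ (refl , refl)
m+1+n≡2 1 (suc n) ()
m+1+n≡2 (suc (suc m)) n eq = ⊥-elim (m+1+n≢0 m (suc-injective (suc-injective eq)))

module Words {X : Set} (_≟_ : DecidableEquality X) where

  occ : X → List X → ℕ
  occ x [] = 0
  occ x (z ∷ w) with z ≟ x
  ... | yes _ = suc (occ x w)
  ... | no  _ = occ x w

  occ-++ : ∀ x u v → occ x (u ++ v) ≡ occ x u + occ x v
  occ-++ x []      v = refl
  occ-++ x (z ∷ u) v with z ≟ x
  ... | yes _ = cong suc (occ-++ x u v)
  ... | no  _ = occ-++ x u v

  occ-here : ∀ x w → occ x (x ∷ w) ≡ suc (occ x w)
  occ-here x w with x ≟ x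
  ... | yes _  = refl
  ... | no x≢x = ⊥-elim (x≢x refl)

  occ-there : ∀ {x z} w → z ≢ x → occ x (z ∷ w) ≡ occ x w
  occ-there {x} {z} w z≢x with z ≟ x
  ... | yes z≡x = ⊥-elim (z≢x z≡x)
  ... | no  _   = refl

  occ⇒∈ : ∀ x w {n} → occ x w ≡ suc n → x ∈ w
  occ⇒∈ x (z ∷ w) eq with z ≟ x
  ... | yes z≡x = here (sym z≡x)
  ... | no  _   = there (occ⇒∈ x w eq)

  only : X → X → List X → List X
  only = restrict _≟_

  only-++ : ∀ x y u v → only x y (u ++ v) ≡ only x y u ++ only x y v
  only-++ x y []      v = refl
  only-++ x y (z ∷ u) v with z ≟ x | z ≟ y
  ... | yes _ | _     = cong (z ∷_) (only-++ x y u v)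
  ... | no  _ | yes _ = cong (z ∷_) (only-++ x y u v)
  ... | no  _ | no  _ = only-++ x y u v

  only-keep : ∀ {x y z} w → z ≡ x ⊎ z ≡ y → only x y (z ∷ w) ≡ z ∷ only x y w
  only-keep {x} {y} {z} w z∈xy with z ≟ x | z ≟ y
  only-keep w _          | yes _   | _     = refl
  only-keep w _          | no  _   | yes _ = refl
  only-keep w (inj₁ z≡x) | no  z≢x | no  _ = ⊥-elim (z≢x z≡x)
  only-keep w (inj₂ z≡y) | no  _ | no z≢y  = ⊥-elim (z≢y z≡y)

  only-comm : ∀ x y w → only x y w ≡ only y x w
  only-comm x y []      = refl
  only-comm x y (z ∷ w) with z ≟ x | z ≟ y
  ... | yes _ | yes _ = cong (z ∷_) (only-comm x y w)
  ... | yes _ | no  _ = cong (z ∷_) (only-comm x y w)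
  ... | no  _ | yes _ = cong (z ∷_) (only-comm x y w)
  ... | no  _ | no  _ = only-comm x y w

  only-absent : ∀ x y w → occ x w ≡ 0 → occ y w ≡ 0 → only x y w ≡ []
  only-absent x y []      _  _  = refl
  only-absent x y (z ∷ w) ox oy with z ≟ x | z ≟ y
  only-absent x y (z ∷ w) () oy | yes _ | _
  only-absent x y (z ∷ w) ox () | no  _ | yes _
  ... | no _ | no _ = only-absent x y w ox oy

  only-single : ∀ x y w → occ x w ≡ 1 → occ y w ≡ 0 → only x y w ≡ x ∷ []
  only-single x y (z ∷ w) ox oy with z ≟ x | z ≟ y
  only-single x y (z ∷ w) ox ()  | _        | yes _
  only-single x y (z ∷ w) ox oy  | yes refl | no  _ =
    cong (x ∷_) (only-absent x y w (suc-injective ox) oy)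
  ... | no _ | no _ = only-single x y w ox oy

  only-pair : ∀ x y w → x ≢ y → occ x w ≡ 1 → occ y w ≡ 1 →
              only x y w ≡ x ∷ y ∷ [] ⊎ only x y w ≡ y ∷ x ∷ []
  only-pair x y (z ∷ w) x≢y ox oy with z ≟ x | z ≟ y
  ... | yes refl | yes refl = ⊥-elim (x≢y refl)
  ... | yes refl | no _ = inj₁ (cong (x ∷_) (trans (only-comm x y w)
                                 (only-single y x w oy (suc-injective ox))))
  ... | no _ | yes refl = inj₂ (cong (y ∷_) (only-single x y w ox (suc-injective oy)))
  ... | no _ | no _ = only-pair x y w x≢y ox oy

  only-around : ∀ {x y z} u v t → z ≡ x ⊎ z ≡ y →
                only x y (u ++ z ∷ v ++ z ∷ t) ≡ only x y u ++ z ∷ only x y v ++ z ∷ only x y t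
  only-around {x} {y} {z} u v t z∈xy = begin
    only x y (u ++ z ∷ v ++ z ∷ t)                ≡⟨ only-++ x y u _ ⟩
    only x y u ++ only x y (z ∷ v ++ z ∷ t)       ≡⟨ cong (only x y u ++_) (only-keep _ z∈xy) ⟩
    only x y u ++ z ∷ only x y (v ++ z ∷ t)       ≡⟨ cong (λ r → only x y u ++ z ∷ r) (only-++ x y v _) ⟩
    only x y u ++ z ∷ only x y v ++ only x y (z ∷ t)
      ≡⟨ cong (λ r → only x y u ++ z ∷ only x y v ++ r) (only-keep t z∈xy) ⟩
    only x y u ++ z ∷ only x y v ++ z ∷ only x y t ∎
    where open ≡-Reasoning

  Alternate-comm : ∀ x y w → Alternate _≟_ x y w → Alternate _≟_ y x w
  Alternate-comm x y w = subst NoAdjRepeat (only-comm x y w)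

  NoAdjRepeat-∷⁻ : ∀ (z : X) l → NoAdjRepeat (z ∷ l) → NoAdjRepeat l
  NoAdjRepeat-∷⁻ z []      _       = tt
  NoAdjRepeat-∷⁻ z (_ ∷ _) (_ , h) = h

  NoAdjRepeat-++⁻ʳ : ∀ (u v : List X) → NoAdjRepeat (u ++ v) → NoAdjRepeat v
  NoAdjRepeat-++⁻ʳ []      v h = h
  NoAdjRepeat-++⁻ʳ (z ∷ u) v h = NoAdjRepeat-++⁻ʳ u v (NoAdjRepeat-∷⁻ z (u ++ v) h)

  only-single′ : ∀ x y w → occ x w ≡ 0 → occ y w ≡ 1 → only x y w ≡ y ∷ []
  only-single′ x y w ox oy = trans (only-comm x y w) (only-single y x w oy ox)

  occ-around : ∀ {y z} u v t → z ≢ y → occ y (u ++ z ∷ v ++ z ∷ t) ≡ occ y u + (occ y v + occ y t)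
  occ-around {y} {z} u v t z≢y = begin
    occ y (u ++ z ∷ v ++ z ∷ t)         ≡⟨ occ-++ y u _ ⟩
    occ y u + occ y (z ∷ v ++ z ∷ t)    ≡⟨ cong (occ y u +_) (occ-there _ z≢y) ⟩
    occ y u + occ y (v ++ z ∷ t)        ≡⟨ cong (occ y u +_) (occ-++ y v _) ⟩
    occ y u + (occ y v + occ y (z ∷ t)) ≡⟨ cong (λ n → occ y u + (occ y v + n)) (occ-there t z≢y) ⟩
    occ y u + (occ y v + occ y t)       ∎
    where open ≡-Reasoning

  repeat⇒¬Alternate : ∀ {x y z w} u v t → w ≡ u ++ z ∷ v ++ z ∷ t → z ≡ x ⊎ z ≡ y →
                      occ x v ≡ 0 → occ y v ≡ 0 → ¬ Alternate _≟_ x y w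
  repeat⇒¬Alternate {x} {y} {z} u v t refl z∈xy ox oy alt =
    proj₁ (NoAdjRepeat-++⁻ʳ (only x y u) _ (subst NoAdjRepeat squeezed alt)) refl
    where
    squeezed : only x y (u ++ z ∷ v ++ z ∷ t) ≡ only x y u ++ z ∷ z ∷ only x y t
    squeezed = trans (only-around u v t z∈xy)
      (cong (λ r → only x y u ++ z ∷ r ++ z ∷ only x y t) (only-absent x y v ox oy))

  Alternate-doubled : ∀ {x y} w → x ≢ y → occ x w ≡ 1 → occ y w ≡ 1 → Alternate _≟_ x y (w ++ w)
  Alternate-doubled {x} {y} w x≢y ox oy =
    subst NoAdjRepeat (sym (only-++ x y w w)) (doubled (only-pair x y w x≢y ox oy))
    where
    y≢x : y ≢ x
    y≢x = x≢y ∘ sym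
    doubled : only x y w ≡ x ∷ y ∷ [] ⊎ only x y w ≡ y ∷ x ∷ [] → NoAdjRepeat (only x y w ++ only x y w)
    doubled (inj₁ eq) = subst (λ r → NoAdjRepeat (r ++ r)) (sym eq) (x≢y , y≢x , x≢y , tt)
    doubled (inj₂ eq) = subst (λ r → NoAdjRepeat (r ++ r)) (sym eq) (y≢x , x≢y , y≢x , tt)

  record Around (z : X) (mid w : List X) : Set where
    constructor around
    field
      pre post  : List X
      split     : w ≡ pre ++ z ∷ mid ++ z ∷ post
      pre-free  : occ z pre ≡ 0
      mid-free  : occ z mid ≡ 0
      post-free : occ z post ≡ 0

  Around-++ˡ : ∀ {z v w} u → occ z u ≡ 0 → Around z v w → Around z v (u ++ w)
  Around-++ˡ {z} u oz (around pre post refl o₁ o₂ o₃) =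
    around (u ++ pre) post (sym (++-assoc u pre _)) (trans (occ-++ z u pre) (cong₂ _+_ oz o₁)) o₂ o₃

  Around-++ʳ : ∀ {z v w} t → occ z t ≡ 0 → Around z v w → Around z v (w ++ t)
  Around-++ʳ {z} {mid} t oz (around pre post refl o₁ o₂ o₃) =
    around pre (post ++ t)
      (trans (++-assoc pre _ t) (cong (λ r → pre ++ z ∷ r) (++-assoc mid (z ∷ post) t)))
      o₁ o₂ (trans (occ-++ z post t) (cong₂ _+_ o₃ oz))

  Around⇒Alternate : ∀ {x y v w} → Around x v w → x ≢ y → occ y v ≡ 1 → occ y w ≡ 2 →
                     Alternate _≟_ x y w
  Around⇒Alternate {x} {y} {v} (around u t refl ou ov ot) x≢y oyv oyw =
    subst NoAdjRepeat (sym (only-around u v t (inj₁ refl)))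
      (frame (m+1+n≡2 (occ y u) (occ y t) (trans (cong (occ y u +_) (cong (_+ occ y t) (sym oyv)))
                                                (trans (sym (occ-around u v t x≢y)) oyw))))
    where
    y≢x : y ≢ x
    y≢x = x≢y ∘ sym
    frame : (occ y u ≡ 0 × occ y t ≡ 1) ⊎ (occ y u ≡ 1 × occ y t ≡ 0) →
            NoAdjRepeat (only x y u ++ x ∷ only x y v ++ x ∷ only x y t)
    frame (inj₁ (yu , yt)) rewrite only-absent x y u ou yu | only-single′ x y v ov oyv
                                 | only-single′ x y t ot yt = x≢y , y≢x , x≢y , tt
    frame (inj₂ (yu , yt)) rewrite only-single′ x y u ou yu | only-single′ x y v ov oyv
                                 | only-absent x y t ot yt = y≢x , x≢y , y≢x , tt

  Around⇒¬Alternate : ∀ {x y v w} → Around x v w → occ y v ≡ 0 → ¬ Alternate _≟_ x y w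
  Around⇒¬Alternate (around u t split _ ov _) oyv = repeat⇒¬Alternate u _ t split (inj₁ refl) ov oyv

  occ-filterᵇ : ∀ f x w → f x ≡ true → occ x (filterᵇ f w) ≡ occ x w
  occ-filterᵇ f x []      _  = refl
  occ-filterᵇ f x (z ∷ w) fx with f z in fz
  ... | true with z ≟ x
  ...   | yes _ = cong suc (occ-filterᵇ f x w fx)
  ...   | no  _ = occ-filterᵇ f x w fx
  occ-filterᵇ f x (z ∷ w) fx | false =
    trans (occ-filterᵇ f x w fx) (sym (occ-there w λ { refl → true≢false (trans (sym fx) fz) }))

  only-filterᵇ : ∀ f x y w → f x ≡ true → f y ≡ true → only x y (filterᵇ f w) ≡ only x y w
  only-filterᵇ f x y []      _  _  = refl
  only-filterᵇ f x y (z ∷ w) fx fy with f z in fz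
  ... | true with z ≟ x | z ≟ y
  ...   | yes _ | _     = cong (z ∷_) (only-filterᵇ f x y w fx fy)
  ...   | no  _ | yes _ = cong (z ∷_) (only-filterᵇ f x y w fx fy)
  ...   | no  _ | no  _ = only-filterᵇ f x y w fx fy
  only-filterᵇ f x y (z ∷ w) fx fy | false with z ≟ x | z ≟ y
  ...   | yes refl | _        = ⊥-elim (true≢false (trans (sym fx) fz))
  ...   | no  _    | yes refl = ⊥-elim (true≢false (trans (sym fy) fz))
  ...   | no  _    | no  _    = only-filterᵇ f x y w fx fy

  blocks : (ℕ → List X) → ℕ → ℕ → List X
  blocks f s zero    = []
  blocks f s (suc l) = f s ++ blocks f (suc s) l

  blocks-without : ∀ x f s l → (∀ m → s ≤ m → m < s + l → occ x (f m) ≡ 0) → occ x (blocks f s l) ≡ 0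
  blocks-without x f s zero    _  = refl
  blocks-without x f s (suc l) ox = trans (occ-++ x (f s) _)
    (cong₂ _+_ (ox s ≤-refl (subst (s <_) (sym (+-suc s l)) (s≤s (m≤m+n s l))))
               (blocks-without x f (suc s) l λ m s<m m<s+l →
                  ox m (≤-trans (n≤1+n s) s<m) (subst (m <_) (sym (+-suc s l)) m<s+l)))

  blocks-around : ∀ {x v m₀} f s l → (∀ m → m ≢ m₀ → occ x (f m) ≡ 0) → s ≤ m₀ → m₀ < s + l →
                  Around x v (f m₀) → Around x v (blocks f s l)
  blocks-around {m₀ = m₀} f s zero _ s≤m₀ m₀<s _ =
    ⊥-elim (<⇒≱ (subst (m₀ <_) (+-identityʳ s) m₀<s) s≤m₀)
  blocks-around {m₀ = m₀} f s (suc l) ox s≤m₀ m₀<s+l fm₀ with s ≟ℕ m₀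
  ... | yes refl = Around-++ʳ _ (blocks-without _ f (suc s) l λ m s<m _ → ox m (>⇒≢ s<m)) fm₀
  ... | no  s≢m₀ = Around-++ˡ (f s) (ox s s≢m₀)
    (blocks-around f (suc s) l ox (≤∧≢⇒< s≤m₀ s≢m₀) (subst (m₀ <_) (+-suc s l) m₀<s+l) fm₀)

  All-blocks : ∀ {P : X → Set} f s l → (∀ m → s ≤ m → m < s + l → All P (f m)) → All P (blocks f s l)
  All-blocks f s zero    _  = []
  All-blocks f s (suc l) Pf = ++⁺ (Pf s ≤-refl (subst (s <_) (sym (+-suc s l)) (s≤s (m≤m+n s l))))
    (All-blocks f (suc s) l λ m s<m m<s+l →
       Pf m (≤-trans (n≤1+n s) s<m) (subst (m <_) (sym (+-suc s l)) m<s+l))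

module Relabelling {X Y : Set} (_≟X_ : DecidableEquality X) (_≟Y_ : DecidableEquality Y)
                   (f : X → Y) (f-injective : Injective _≡_ _≡_ f) where

  map-restrict : ∀ x y w → map f (restrict _≟X_ x y w) ≡ restrict _≟Y_ (f x) (f y) (map f w)
  map-restrict x y []      = refl
  map-restrict x y (z ∷ w) with z ≟X x | z ≟X y | f z ≟Y f x | f z ≟Y f y
  ... | yes _   | _       | yes _   | _       = cong (f z ∷_) (map-restrict x y w)
  ... | yes z≡x | _       | no  fz≢ | _       = ⊥-elim (fz≢ (cong f z≡x))
  ... | no  _   | yes _   | no  _   | yes _   = cong (f z ∷_) (map-restrict x y w)
  ... | no  _   | yes z≡y | no  _   | no  fz≢ = ⊥-elim (fz≢ (cong f z≡y))
  ... | no  z≢x | _       | yes fz≡ | _       = ⊥-elim (z≢x (f-injective fz≡))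
  ... | no  _   | no  z≢y | no  _   | yes fz≡ = ⊥-elim (z≢y (f-injective fz≡))
  ... | no  _   | no  _   | no  _   | no  _   = map-restrict x y w

  NoAdjRepeat-map⇔ : ∀ l → NoAdjRepeat (map f l) ⇔ NoAdjRepeat l
  NoAdjRepeat-map⇔ l = mk⇔ (from l) (to l)
    where
    to : ∀ l → NoAdjRepeat l → NoAdjRepeat (map f l)
    to []          _       = tt
    to (_ ∷ [])    _       = tt
    to (p ∷ q ∷ l) (p≢q , h) = p≢q ∘ f-injective , to (q ∷ l) h
    from : ∀ l → NoAdjRepeat (map f l) → NoAdjRepeat l
    from []          _       = tt
    from (_ ∷ [])    _       = tt
    from (p ∷ q ∷ l) (fp≢fq , h) = fp≢fq ∘ cong f , from (q ∷ l) h

  Alternate-map⇔ : ∀ x y w → Alternate _≟Y_ (f x) (f y) (map f w) ⇔ Alternate _≟X_ x y w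
  Alternate-map⇔ x y w =
    subst (λ l → NoAdjRepeat l ⇔ Alternate _≟X_ x y w) (map-restrict x y w) (NoAdjRepeat-map⇔ _)

double : ℕ → ℕ
double zero    = zero
double (suc m) = suc (suc (double m))

double-injective : Injective _≡_ _≡_ double
double-injective {zero}  {zero}  _  = refl
double-injective {suc m} {suc n} eq = cong suc (double-injective (suc-injective (suc-injective eq)))

double≢suc-double : ∀ m n → double m ≢ suc (double n)
double≢suc-double zero    n       ()
double≢suc-double (suc m) zero    ()
double≢suc-double (suc m) (suc n) eq = double≢suc-double m n (suc-injective (suc-injective eq))

suc-double-< : ∀ {m n} → m < n → suc (double m) < double n
suc-double-< {zero}  {suc n} _         = s≤s (s≤s z≤n)
suc-double-< {suc m} {suc n} (s≤s m<n) = s≤s (s≤s (suc-double-< m<n))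

double-< : ∀ {m n} → m < n → double m < double n
double-< m<n = ≤-trans (n≤1+n _) (suc-double-< m<n)

data Halving (n : ℕ) : ℕ → Set where
  even : ∀ {m} → m < n → Halving n (double m)
  odd  : ∀ {m} → m < n → Halving n (suc (double m))

halving : ∀ {n} j → j < double n → Halving n j
halving {suc n} zero          _               = even (s≤s z≤n)
halving {suc n} (suc zero)    _               = odd (s≤s z≤n)
halving {suc n} (suc (suc j)) (s≤s (s≤s j<)) with halving j j<
... | even m<n = even (s≤s m<n)
... | odd  m<n = odd (s≤s m<n)

-- The vertices of F₂(k) with unbounded indices, so that the word is built uniformly in k.
data Letter : Set where
  C : ℕ → Letter
  B : Letter
  A : ℕ → Letter

C-injective : ∀ {m n} → C m ≡ C n → m ≡ n
C-injective refl = refl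

A-injective : ∀ {m n} → A m ≡ A n → m ≡ n
A-injective refl = refl

_≟L_ : DecidableEquality Letter
C m ≟L C n = map′ (cong C) C-injective (m ≟ℕ n)
C _ ≟L B   = no λ ()
C _ ≟L A _ = no λ ()
B   ≟L C _ = no λ ()
B   ≟L B   = yes refl
B   ≟L A _ = no λ ()
A _ ≟L C _ = no λ ()
A _ ≟L B   = no λ ()
A m ≟L A n = map′ (cong A) A-injective (m ≟ℕ n)

open Words _≟L_

block : ℕ → List Letter
block j = A j ∷ C j ∷ C (suc j) ∷ A j ∷ []

evenBlocks oddBlocks : ℕ → ℕ → List Letter
evenBlocks = blocks (block ∘ double)
oddBlocks  = blocks (block ∘ suc ∘ double)

firstRound secondRound closing : ℕ → List Letter
firstRound  p = evenBlocks 0 (suc p) ++ C (double (suc p)) ∷ C 0 ∷ []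
secondRound p = oddBlocks 0 p ++ A (suc (double p)) ∷ C (suc (double p)) ∷ []
closing     p = C (double (suc p)) ∷ A (suc (double p)) ∷ []

word : ℕ → List Letter
word p = B ∷ firstRound p ++ B ∷ secondRound p ++ B ∷ closing p

isC : Letter → Bool
isC (C _) = true
isC _     = false

cRun : ℕ → ℕ → List Letter
cRun s zero    = []
cRun s (suc l) = C s ∷ cRun (suc s) l

cRun-snoc : ∀ s l r → cRun s l ++ C (s + l) ∷ r ≡ cRun s (suc l) ++ r
cRun-snoc s zero    r = cong (λ n → C n ∷ r) (+-identityʳ s)
cRun-snoc s (suc l) r = cong (C s ∷_) (trans (cong (λ n → cRun (suc s) l ++ C n ∷ r) (+-suc s l))
                                             (cRun-snoc (suc s) l r))

occ-cRun-outside : ∀ i s l → i < s ⊎ s + l ≤ i → occ (C i) (cRun s l) ≡ 0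
occ-cRun-outside i s zero    _ = refl
occ-cRun-outside i s (suc l) i∉ = trans (occ-there _ (s≢i i∉)) (occ-cRun-outside i (suc s) l (shift i∉))
  where
  s≢i : i < s ⊎ s + suc l ≤ i → C s ≢ C i
  s≢i (inj₁ i<s) = >⇒≢ i<s ∘ C-injective
  s≢i (inj₂ s+1+l≤i) = <⇒≢ (≤-trans (s≤s (m≤m+n s l)) (subst (_≤ i) (+-suc s l) s+1+l≤i)) ∘ C-injective
  shift : i < s ⊎ s + suc l ≤ i → i < suc s ⊎ suc s + l ≤ i
  shift (inj₁ i<s)   = inj₁ (m<n⇒m<1+n i<s)
  shift (inj₂ s+1+l≤i) = inj₂ (subst (_≤ i) (+-suc s l) s+1+l≤i)

occ-cRun-inside : ∀ i s l → s ≤ i → i < s + l → occ (C i) (cRun s l) ≡ 1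
occ-cRun-inside i s zero s≤i i<s = ⊥-elim (<⇒≱ (subst (i <_) (+-identityʳ s) i<s) s≤i)
occ-cRun-inside i s (suc l) s≤i i<s+l with m≤n⇒m<n∨m≡n s≤i
... | inj₂ refl = trans (occ-here (C s) _) (cong suc (occ-cRun-outside s (suc s) l (inj₁ ≤-refl)))
... | inj₁ s<i  = trans (occ-there _ (<⇒≢ s<i ∘ C-injective))
                    (occ-cRun-inside i (suc s) l s<i (subst (i <_) (+-suc s l) i<s+l))

cLetters : List Letter → List Letter
cLetters = filterᵇ isC

cLetters-++ : ∀ u v → cLetters (u ++ v) ≡ cLetters u ++ cLetters v
cLetters-++ = filter-++ (T? ∘ isC)

occ-C-cLetters : ∀ i w → occ (C i) (cLetters w) ≡ occ (C i) w
occ-C-cLetters i w = occ-filterᵇ isC (C i) w refl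

cLetters-evenBlocks : ∀ s l → cLetters (evenBlocks s l) ≡ cRun (double s) (double l)
cLetters-evenBlocks s zero    = refl
cLetters-evenBlocks s (suc l) =
  cong (λ r → C (double s) ∷ C (suc (double s)) ∷ r) (cLetters-evenBlocks (suc s) l)

cLetters-oddBlocks : ∀ s l → cLetters (oddBlocks s l) ≡ cRun (suc (double s)) (double l)
cLetters-oddBlocks s zero    = refl
cLetters-oddBlocks s (suc l) =
  cong (λ r → C (suc (double s)) ∷ C (double (suc s)) ∷ r) (cLetters-oddBlocks (suc s) l)

occ-block : ∀ j {j′} → j′ ≢ j → occ (A j) (block j′) ≡ 0
occ-block j j′≢j = trans (occ-there _ (j′≢j ∘ A-injective)) (occ-there [] (j′≢j ∘ A-injective))

inner-around : ∀ j → Around (A j) (C j ∷ C (suc j) ∷ []) (block j)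
inner-around j = around [] [] refl refl refl refl

-- What the two occurrences of aⱼ enclose in the word.
data Gap (p : ℕ) : ℕ → List Letter → Set where
  inner : ∀ {j} → Gap p j (C j ∷ C (suc j) ∷ [])
  final : Gap p (suc (double p)) (C (suc (double p)) ∷ B ∷ C (double (suc p)) ∷ [])

C≢C-suc : ∀ i → C i ≢ C (suc i)
C≢C-suc i = <⇒≢ (n<1+n i) ∘ C-injective

occ-C-gap : ∀ {p j v} i → Gap p j v → occ (C i) v ≡ occ (C i) (C j ∷ []) + occ (C i) (C (suc j) ∷ [])
occ-C-gap {j = j} i inner = occ-++ (C i) (C j ∷ []) (C (suc j) ∷ [])
occ-C-gap {j = j} i final = occ-++ (C i) (C j ∷ []) (B ∷ C (suc j) ∷ [])

occ-C-gap-inside : ∀ {p j v} i → Gap p j v → i ≡ j ⊎ i ≡ suc j → occ (C i) v ≡ 1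
occ-C-gap-inside i gap (inj₁ refl) =
  trans (occ-C-gap i gap) (cong₂ _+_ (occ-here (C i) []) (occ-there [] (C≢C-suc i ∘ sym)))
occ-C-gap-inside {j = j} i gap (inj₂ refl) =
  trans (occ-C-gap i gap) (cong₂ _+_ (occ-there [] (C≢C-suc j)) (occ-here (C i) []))

occ-C-gap-outside : ∀ {p j v} i → Gap p j v → i ≢ j → i ≢ suc j → occ (C i) v ≡ 0
occ-C-gap-outside i gap i≢j i≢1+j = trans (occ-C-gap i gap)
  (cong₂ _+_ (occ-there [] (i≢j ∘ sym ∘ C-injective)) (occ-there [] (i≢1+j ∘ sym ∘ C-injective)))

occ-A-gap : ∀ {p j v} i → Gap p j v → occ (A i) v ≡ 0
occ-A-gap i inner = refl
occ-A-gap i final = refl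

module _ (p : ℕ) where

  private
    n = double (suc p)

  cLetters-firstRound : cLetters (firstRound p) ≡ cRun 0 (suc n) ++ C 0 ∷ []
  cLetters-firstRound = begin
    cLetters (evenBlocks 0 (suc p) ++ C n ∷ C 0 ∷ [])  ≡⟨ cLetters-++ (evenBlocks 0 (suc p)) _ ⟩
    cLetters (evenBlocks 0 (suc p)) ++ C n ∷ C 0 ∷ []
      ≡⟨ cong (_++ C n ∷ C 0 ∷ []) (cLetters-evenBlocks 0 (suc p)) ⟩
    cRun 0 n ++ C n ∷ C 0 ∷ []                          ≡⟨ cRun-snoc 0 n _ ⟩
    cRun 0 (suc n) ++ C 0 ∷ []                          ∎
    where open ≡-Reasoning

  cLetters-secondRound : cLetters (secondRound p) ≡ cRun 1 (suc (double p))
  cLetters-secondRound = begin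
    cLetters (oddBlocks 0 p ++ A (suc (double p)) ∷ C (suc (double p)) ∷ [])
      ≡⟨ cLetters-++ (oddBlocks 0 p) _ ⟩
    cLetters (oddBlocks 0 p) ++ C (suc (double p)) ∷ []
      ≡⟨ cong (_++ C (suc (double p)) ∷ []) (cLetters-oddBlocks 0 p) ⟩
    cRun 1 (double p) ++ C (suc (double p)) ∷ []      ≡⟨ cRun-snoc 1 (double p) [] ⟩
    cRun 1 (suc (double p)) ++ []                     ≡⟨ ++-identityʳ _ ⟩
    cRun 1 (suc (double p))                           ∎
    where open ≡-Reasoning

  cLetters-word : cLetters (word p) ≡ cRun 0 (suc n) ++ cRun 0 (suc n)
  cLetters-word = begin
    cLetters (firstRound p ++ B ∷ secondRound p ++ B ∷ closing p)
      ≡⟨ cLetters-++ (firstRound p) _ ⟩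
    cLetters (firstRound p) ++ cLetters (secondRound p ++ B ∷ closing p)
      ≡⟨ cong₂ _++_ cLetters-firstRound (cLetters-++ (secondRound p) _) ⟩
    (cRun 0 (suc n) ++ C 0 ∷ []) ++ cLetters (secondRound p) ++ C n ∷ []
      ≡⟨ ++-assoc (cRun 0 (suc n)) _ _ ⟩
    cRun 0 (suc n) ++ C 0 ∷ cLetters (secondRound p) ++ C n ∷ []
      ≡⟨ cong (λ r → cRun 0 (suc n) ++ C 0 ∷ r ++ C n ∷ []) cLetters-secondRound ⟩
    cRun 0 (suc n) ++ C 0 ∷ cRun 1 (suc (double p)) ++ C n ∷ []
      ≡⟨ cong (λ r → cRun 0 (suc n) ++ C 0 ∷ r)
              (trans (cRun-snoc 1 (suc (double p)) []) (++-identityʳ _)) ⟩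
    cRun 0 (suc n) ++ cRun 0 (suc n)                  ∎
    where open ≡-Reasoning

  occ-C-word : ∀ i → i < suc n → occ (C i) (word p) ≡ 2
  occ-C-word i i<k = begin
    occ (C i) (word p)                              ≡⟨ occ-C-cLetters i (word p) ⟨
    occ (C i) (cLetters (word p))                   ≡⟨ cong (occ (C i)) cLetters-word ⟩
    occ (C i) (cRun 0 (suc n) ++ cRun 0 (suc n))    ≡⟨ occ-++ (C i) (cRun 0 (suc n)) _ ⟩
    occ (C i) (cRun 0 (suc n)) + occ (C i) (cRun 0 (suc n))  ≡⟨ cong₂ _+_ once once ⟩
    2                                               ∎
    where
    open ≡-Reasoning
    once : occ (C i) (cRun 0 (suc n)) ≡ 1
    once = occ-cRun-inside i 0 (suc n) z≤n i<k

  occ-oddA-firstRound : ∀ m → occ (A (suc (double m))) (firstRound p) ≡ 0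
  occ-oddA-firstRound m = trans (occ-++ (A (suc (double m))) (evenBlocks 0 (suc p)) _)
    (cong (_+ 0) (blocks-without (A (suc (double m))) (block ∘ double) 0 (suc p) λ m′ _ _ →
                    occ-block (suc (double m)) (double≢suc-double m′ m)))

  occ-evenA-laterRounds : ∀ m → occ (A (double m)) (secondRound p ++ B ∷ closing p) ≡ 0
  occ-evenA-laterRounds m = trans (occ-++ (A (double m)) (secondRound p) _) (cong₂ _+_
    (trans (occ-++ (A (double m)) (oddBlocks 0 p) _) (cong₂ _+_
      (blocks-without (A (double m)) (block ∘ suc ∘ double) 0 p λ m′ _ _ →
         occ-block (double m) (double≢suc-double m m′ ∘ sym))
      (occ-there _ odd≢even)))
    (occ-there [] odd≢even))
    where
    odd≢even : A (suc (double p)) ≢ A (double m)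
    odd≢even e = double≢suc-double m p (sym (A-injective e))

  Around-laterRounds : ∀ {j v} → occ (A j) (firstRound p) ≡ 0 →
                       Around (A j) v (secondRound p ++ B ∷ closing p) → Around (A j) v (word p)
  Around-laterRounds first-free =
    Around-++ˡ (B ∷ []) refl ∘ Around-++ˡ (firstRound p) first-free ∘ Around-++ˡ (B ∷ []) refl

  evenA-around : ∀ {m} → m < suc p →
                 Around (A (double m)) (C (double m) ∷ C (suc (double m)) ∷ []) (word p)
  evenA-around {m} m<1+p = Around-++ˡ (B ∷ []) refl
    (Around-++ʳ _ (occ-evenA-laterRounds m)
      (Around-++ʳ (C n ∷ C 0 ∷ []) refl
        (blocks-around (block ∘ double) 0 (suc p)
                       (λ m′ m′≢m → occ-block (double m) (m′≢m ∘ double-injective))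
                       z≤n m<1+p (inner-around (double m)))))

  oddA-around : ∀ {m} → m < p →
                Around (A (suc (double m))) (C (suc (double m)) ∷ C (double (suc m)) ∷ []) (word p)
  oddA-around {m} m<p = Around-laterRounds (occ-oddA-firstRound m)
    (Around-++ʳ (B ∷ closing p) (occ-there [] last≢j)
      (Around-++ʳ (A (suc (double p)) ∷ C (suc (double p)) ∷ []) (occ-there _ last≢j)
        (blocks-around (block ∘ suc ∘ double) 0 p
                       (λ m′ m′≢m → occ-block (suc (double m)) (m′≢m ∘ double-injective ∘ suc-injective))
                       z≤n m<p (inner-around (suc (double m))))))
    where
    last≢j : A (suc (double p)) ≢ A (suc (double m))
    last≢j e = <⇒≢ (s≤s (double-< m<p)) (sym (A-injective e))

  lastA-around : Around (A (suc (double p))) (C (suc (double p)) ∷ B ∷ C n ∷ []) (word p)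
  lastA-around = Around-laterRounds (occ-oddA-firstRound p)
    (around (oddBlocks 0 p) [] (++-assoc (oddBlocks 0 p) _ _) earlier-free refl refl)
    where
    earlier-free : occ (A (suc (double p))) (oddBlocks 0 p) ≡ 0
    earlier-free = blocks-without _ (block ∘ suc ∘ double) 0 p λ m _ m<p →
      occ-block (suc (double p)) (λ e → <⇒≢ m<p (double-injective (suc-injective e)))

  A-around : ∀ j → j < n → ∃ λ v → Around (A j) v (word p) × Gap p j v
  A-around j j<n with halving j j<n
  ... | even m<1+p = _ , evenA-around m<1+p , inner
  ... | odd  m<1+p with m<1+n⇒m<n∨m≡n m<1+p
  ...   | inj₁ m<p  = _ , oddA-around m<p , inner
  ...   | inj₂ refl = _ , lastA-around , final

  occ-C-secondRound : ∀ i → occ (C i) (secondRound p) ≡ occ (C i) (cRun 1 (suc (double p)))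
  occ-C-secondRound i = trans (sym (occ-C-cLetters i (secondRound p))) (cong (occ (C i)) cLetters-secondRound)

  occ-B-firstRound : occ B (firstRound p) ≡ 0
  occ-B-firstRound = trans (occ-++ B (evenBlocks 0 (suc p)) _)
    (cong (_+ 0) (blocks-without B (block ∘ double) 0 (suc p) λ _ _ _ → refl))

  occ-B-secondRound : occ B (secondRound p) ≡ 0
  occ-B-secondRound = trans (occ-++ B (oddBlocks 0 p) _)
    (cong (_+ 0) (blocks-without B (block ∘ suc ∘ double) 0 p λ _ _ _ → refl))

  alternate-cc : ∀ {i j} → i ≢ j → i < suc n → j < suc n → Alternate _≟L_ (C i) (C j) (word p)
  alternate-cc {i} {j} i≢j i<k j<k =
    subst NoAdjRepeat
      (trans (cong (only (C i) (C j)) (sym cLetters-word)) (only-filterᵇ isC (C i) (C j) (word p) refl refl))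
      (Alternate-doubled (cRun 0 (suc n)) (i≢j ∘ C-injective)
        (occ-cRun-inside i 0 (suc n) z≤n i<k) (occ-cRun-inside j 0 (suc n) z≤n j<k))

  alternate-cb : ∀ {i} → 1 ≤ i → i ≤ suc (double p) → Alternate _≟L_ (C i) B (word p)
  alternate-cb {i} 1≤i i≤1+2p =
    subst NoAdjRepeat (sym restricted) ((λ ()) , (λ ()) , (λ ()) , (λ ()) , tt)
    where
    open ≡-Reasoning
    C0≢Ci : C 0 ≢ C i
    C0≢Ci = <⇒≢ 1≤i ∘ C-injective
    Cn≢Ci : C n ≢ C i
    Cn≢Ci = >⇒≢ (s≤s i≤1+2p) ∘ C-injective
    once-first : occ (C i) (firstRound p) ≡ 1
    once-first = begin
      occ (C i) (firstRound p)                          ≡⟨ occ-C-cLetters i (firstRound p) ⟨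
      occ (C i) (cLetters (firstRound p))               ≡⟨ cong (occ (C i)) cLetters-firstRound ⟩
      occ (C i) (cRun 0 (suc n) ++ C 0 ∷ [])            ≡⟨ occ-++ (C i) (cRun 0 (suc n)) _ ⟩
      occ (C i) (cRun 0 (suc n)) + occ (C i) (C 0 ∷ [])
        ≡⟨ cong₂ _+_ (occ-cRun-inside i 0 (suc n) z≤n (m<n⇒m<1+n (s≤s i≤1+2p))) (occ-there [] C0≢Ci) ⟩
      1                                                 ∎
    once-second : occ (C i) (secondRound p) ≡ 1
    once-second = trans (occ-C-secondRound i) (occ-cRun-inside i 1 (suc (double p)) 1≤i (s≤s i≤1+2p))
    restricted : only (C i) B (word p) ≡ B ∷ C i ∷ B ∷ C i ∷ B ∷ []
    restricted = begin
      only (C i) B ((B ∷ firstRound p) ++ B ∷ secondRound p ++ B ∷ closing p)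
        ≡⟨ only-around {C i} {B} (B ∷ firstRound p) (secondRound p) (closing p) (inj₂ refl) ⟩
      B ∷ only (C i) B (firstRound p) ++ B ∷ only (C i) B (secondRound p) ++ B ∷ only (C i) B (closing p)
        ≡⟨ cong₂ (λ r r′ → B ∷ r ++ B ∷ r′ ++ B ∷ only (C i) B (closing p))
                 (only-single (C i) B (firstRound p) once-first occ-B-firstRound)
                 (only-single (C i) B (secondRound p) once-second occ-B-secondRound) ⟩
      B ∷ C i ∷ B ∷ C i ∷ B ∷ only (C i) B (closing p)
        ≡⟨ cong (λ r → B ∷ C i ∷ B ∷ C i ∷ B ∷ r)
                (only-absent (C i) B (closing p) (occ-there _ Cn≢Ci) refl) ⟩
      B ∷ C i ∷ B ∷ C i ∷ B ∷ []                        ∎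

  ¬alternate-cb : ∀ {i} → i < 1 ⊎ n ≤ i → ¬ Alternate _≟L_ (C i) B (word p)
  ¬alternate-cb {i} i∉ =
    repeat⇒¬Alternate (B ∷ firstRound p) (secondRound p) (closing p) refl (inj₂ refl)
      (trans (occ-C-secondRound i) (occ-cRun-outside i 1 (suc (double p)) i∉)) occ-B-secondRound

  alternate-ac : ∀ {i j} → j < n → i ≡ j ⊎ i ≡ suc j → Alternate _≟L_ (A j) (C i) (word p)
  alternate-ac {i} {j} j<n i∈ with A-around j j<n
  ... | _ , frame , gap =
    Around⇒Alternate frame (λ ()) (occ-C-gap-inside i gap i∈) (occ-C-word i (bound i∈))
    where
    bound : i ≡ j ⊎ i ≡ suc j → i < suc n
    bound (inj₁ refl) = m<n⇒m<1+n j<n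
    bound (inj₂ refl) = s≤s j<n

  ¬alternate-ac : ∀ {i j} → j < n → i ≢ j → i ≢ suc j → ¬ Alternate _≟L_ (A j) (C i) (word p)
  ¬alternate-ac {i} {j} j<n i≢j i≢1+j with A-around j j<n
  ... | _ , frame , gap = Around⇒¬Alternate frame (occ-C-gap-outside i gap i≢j i≢1+j)

  ¬alternate-ab : ∀ {j} → j < n → ¬ Alternate _≟L_ (A j) B (word p)
  ¬alternate-ab {j} j<n with A-around j j<n
  ... | _ , frame , inner = Around⇒¬Alternate {y = B} frame refl
  ... | _ , _     , final =
    repeat⇒¬Alternate {A j} {B} [] (firstRound p) (secondRound p ++ B ∷ closing p) refl (inj₂ refl)
      (occ-oddA-firstRound p) occ-B-firstRound

  ¬alternate-aa : ∀ i {j} → j < n → ¬ Alternate _≟L_ (A j) (A i) (word p)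
  ¬alternate-aa i {j} j<n with A-around j j<n
  ... | _ , frame , gap = Around⇒¬Alternate frame (occ-A-gap i gap)

  C-B-neighbour : ∀ i → Alternate _≟L_ (C i) B (word p) → 1 ≤ i × i ≤ suc (double p)
  C-B-neighbour zero    alt = ⊥-elim (¬alternate-cb (inj₁ (s≤s z≤n)) alt)
  C-B-neighbour (suc i) alt with suc i ≤? suc (double p)
  ... | yes i≤1+2p = s≤s z≤n , i≤1+2p
  ... | no  i≰1+2p = ⊥-elim (¬alternate-cb (inj₂ (≰⇒> i≰1+2p)) alt)

  A-C-neighbour : ∀ {i j} → j < n → Alternate _≟L_ (A j) (C i) (word p) → i ≡ j ⊎ i ≡ suc j
  A-C-neighbour {i} {j} j<n alt with i ≟ℕ j | i ≟ℕ suc j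
  ... | yes i≡j | _         = inj₁ i≡j
  ... | no  _   | yes i≡1+j = inj₂ i≡1+j
  ... | no  i≢j | no  i≢1+j = ⊥-elim (¬alternate-ac j<n i≢j i≢1+j alt)

toℕ-mod : ∀ {m d} .{{_ : NonZero d}} → m < d → toℕ (m mod d) ≡ m
toℕ-mod {m} {d} m<d = trans (toℕ-fromℕ< (m%n<n m d)) (m<n⇒m%n≡m m<d)

module Representation (p : ℕ) where

  private
    n = double (suc p)

  V : Set
  V = F2V (suc n)

  code : V → Letter
  code (c i) = C (toℕ i)
  code bv    = B
  code (a j) = A (toℕ j)

  -- Junk on letters that name no vertex (indices are reduced mod k); all letters of the word are Named.
  decode : Letter → V
  decode (C i) = c (i mod suc n)
  decode B     = bv
  decode (A j) = a (j mod n)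

  decode-code : ∀ v → decode (code v) ≡ v
  decode-code (c i) = cong c (toℕ-injective (toℕ-mod (toℕ<n i)))
  decode-code bv    = refl
  decode-code (a j) = cong a (toℕ-injective (toℕ-mod (toℕ<n j)))

  code-injective : Injective _≡_ _≡_ code
  code-injective {u} {v} eq = trans (sym (decode-code u)) (trans (cong decode eq) (decode-code v))

  Named : Letter → Set
  Named (C i) = i < suc n
  Named B     = ⊤
  Named (A j) = j < n

  code-decode : ∀ {z} → Named z → code (decode z) ≡ z
  code-decode {C i} i<k = cong C (toℕ-mod i<k)
  code-decode {B}   _   = refl
  code-decode {A j} j<n = cong A (toℕ-mod j<n)

  All-Named-word : All Named (word p)
  All-Named-word =
    tt ∷ ++⁺ (++⁺ (All-blocks (block ∘ double) 0 (suc p) λ m _ m<1+p → named-block (double-< m<1+p))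
                  (≤-refl ∷ s≤s z≤n ∷ []))
        (tt ∷ ++⁺ (++⁺ (All-blocks (block ∘ suc ∘ double) 0 p λ m _ m<p →
                          named-block (suc-double-< (m<n⇒m<1+n m<p)))
                       (≤-refl ∷ m<n⇒m<1+n ≤-refl ∷ []))
             (tt ∷ ≤-refl ∷ ≤-refl ∷ []))
    where
    named-block : ∀ {j} → j < n → All Named (block j)
    named-block j<n = j<n ∷ m<n⇒m<1+n j<n ∷ s≤s j<n ∷ j<n ∷ []

  map-code-decode : ∀ {zs} → All Named zs → map code (map decode zs) ≡ zs
  map-code-decode []           = refl
  map-code-decode (nz ∷ nzs) = cong₂ _∷_ (code-decode nz) (map-code-decode nzs)

  vertexWord : List V
  vertexWord = map decode (word p)

  alternate⇔ : ∀ x y →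
               Alternate (F2V-≟ (suc n)) x y vertexWord ⇔ Alternate _≟L_ (code x) (code y) (word p)
  alternate⇔ x y =
    subst (λ ws → Alternate (F2V-≟ (suc n)) x y vertexWord ⇔ Alternate _≟L_ (code x) (code y) ws)
          (map-code-decode All-Named-word) (⇔-sym (Alternate-map⇔ x y vertexWord))
    where open Relabelling (F2V-≟ (suc n)) _≟L_ code code-injective

  code∈word : ∀ v → code v ∈ word p
  code∈word (c i) = occ⇒∈ (C (toℕ i)) (word p) (occ-C-word p (toℕ i) (toℕ<n i))
  code∈word bv    = here refl
  code∈word (a j) with A-around p (toℕ j) (toℕ<n j)
  ... | _ , around u _ split _ _ _ , _ = subst (A (toℕ j) ∈_) (sym split) (∈-++⁺ʳ u (here refl))

  flip⇔ : ∀ {P : Set} x y → P ⇔ Alternate _≟L_ x y (word p) → P ⇔ Alternate _≟L_ y x (word p)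
  flip⇔ x y e =
    mk⇔ (Alternate-comm x y (word p) ∘ Equivalence.to e)
        (Equivalence.from e ∘ Alternate-comm y x (word p))

  c-b⇔ : ∀ (i : Fin (suc n)) → InNb i ⇔ Alternate _≟L_ (C (toℕ i)) B (word p)
  c-b⇔ i = mk⇔ (λ (1≤i , i≤1+2p) → alternate-cb p 1≤i i≤1+2p) (C-B-neighbour p (toℕ i))

  a-c⇔ : ∀ (j : Fin n) (i : Fin (suc n)) → InNa j i ⇔ Alternate _≟L_ (A (toℕ j)) (C (toℕ i)) (word p)
  a-c⇔ j i = mk⇔ (alternate-ac p (toℕ<n j)) (A-C-neighbour p (toℕ<n j))

  adjacent⇔ : ∀ x y → x ≢ y → F2Adj (suc n) x y ⇔ Alternate _≟L_ (code x) (code y) (word p)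
  adjacent⇔ (c i) (c j) x≢y = mk⇔ (λ i≢j → alternate-cc p (i≢j ∘ toℕ-injective) (toℕ<n i) (toℕ<n j))
                                  (λ _ i≡j → x≢y (cong c i≡j))
  adjacent⇔ (c i) bv    _   = c-b⇔ i
  adjacent⇔ bv    (c i) _   = flip⇔ (C (toℕ i)) B (c-b⇔ i)
  adjacent⇔ (c i) (a j) _   = flip⇔ (A (toℕ j)) (C (toℕ i)) (a-c⇔ j i)
  adjacent⇔ (a j) (c i) _   = a-c⇔ j i
  adjacent⇔ bv    bv    x≢y = ⊥-elim (x≢y refl)
  adjacent⇔ bv    (a j) _   = flip⇔ (A (toℕ j)) B (mk⇔ ⊥-elim (¬alternate-ab p (toℕ<n j)))
  adjacent⇔ (a j) bv    _   = mk⇔ ⊥-elim (¬alternate-ab p (toℕ<n j))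
  adjacent⇔ (a i) (a j) _   = mk⇔ ⊥-elim (¬alternate-aa p (toℕ j) (toℕ<n i))

  F₂-wordRepresentable : WordRepresentable (F₂ (suc n))
  F₂-wordRepresentable =
    vertexWord , (λ v → subst (_∈ vertexWord) (decode-code v) (∈-map⁺ decode (code∈word v))) ,
    λ x y x≢y → ⇔-sym (alternate⇔ x y) ⇔-∘ adjacent⇔ x y x≢y

double≡*2 : ∀ q → double q ≡ q * 2
double≡*2 zero    = refl
double≡*2 (suc q) = cong (suc ∘ suc) (double≡*2 q)

odd≥5⇒≡2p+3 : ∀ k → 5 ≤ k → k % 2 ≡ 1 → ∃ λ p → k ≡ suc (double (suc p))
odd≥5⇒≡2p+3 k 5≤k k-odd =
  halve (k / 2) (trans (m≡m%n+[m/n]*n k 2) (cong₂ _+_ k-odd (sym (double≡*2 (k / 2)))))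
  where
  halve : ∀ q → k ≡ suc (double q) → ∃ λ p → k ≡ suc (double (suc p))
  halve zero    k≡1 = ⊥-elim (<⇒≱ (s≤s (s≤s z≤n)) (subst (5 ≤_) k≡1 5≤k))
  halve (suc p) k≡  = p , k≡

lemma14 : ∀ (k : ℕ) → 5 ≤ k → k % 2 ≡ 1 → WordRepresentable (F₂ k)
lemma14 k 5≤k k-odd with odd≥5⇒≡2p+3 k 5≤k k-odd
... | p , refl = Representation.F₂-wordRepresentable p
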